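{- The type $\mathsf{lang}_\Sigma$ with zero $\emptyset$, one $\epsilon$, and operations $+$, $\cdot$ and ${}^*$ forms a Kleene algebra: $+$ is associative, commutative and idempotent with identity $\emptyset$; $\cdot$ is associative with two-sided identity $\epsilon$; $\cdot$ distributes over $+$ on both sides; $\emptyset$ is a two-sided annihilator for $\cdot$; and, writing $x\le y$ for $x+y=y$, for all $a,b,x$: $\epsilon + a\cdot a^*\le a^*$, $\epsilon + a^*\cdot a\le a^*$, $b + a\cdot x\le x \Rightarrow a^*\cdot b\le x$, and $b + x\cdot a\le x\Rightarrow b\cdot a^*\le x$.
   Context: $\Sigma$ is a fixed finite alphabet. $\mathsf{lang}_\Sigma$ is the coinductive type with single constructor $\mathsf{lnode}\,b\,k$ ($b:\mathbb{B}$, $k:\Sigma\to\mathsf{lang}_\Sigma$), ordered coinductively by $\mathsf{lnode}\,b_1\,f\sqsubseteq\mathsf{lnode}\,b_2\,g$ if $b_1\sqsubseteq b_2$ (with $\mathbf{false}\sqsubseteq\mathbf{true}$) and $f\,a\sqsubseteq g\,a$ for all $a$; order-equivalent languages are assumed equal (axiom). $\mathsf{o}(\mathsf{lnode}\,b\,\_)=b$, $\delta_{\mathsf{lnode}\,\_\,k}\,x = k\,x$. Corecursively: $\emptyset=\mathsf{lnode}\,\mathbf{false}\,(\lambda\_.\emptyset)$; $\epsilon=\mathsf{lnode}\,\mathbf{true}\,(\lambda\_.\emptyset)$; $a+b=\mathsf{lnode}(\mathsf{o}\,a\lor\mathsf{o}\,b)(\lambda x.\,\delta_a x+\delta_b x)$.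 Basis: the inductive type $\mathsf{tlang}_\Sigma$ with constructors $\bot$ and $\mathsf{tlnode}\,b\,k$ ($k:\Sigma\to\mathsf{tlang}_\Sigma$); $\mathsf{is\_bot}$ holds of $\bot$ and of $\mathsf{tlnode}\,\mathbf{false}\,k$ when it holds of all $k\,a$; order: $t_1\sqsubseteq t_2$ if $\mathsf{is\_bot}\,t_1$, or $t_1=\mathsf{tlnode}\,b_1\,f$, $t_2=\mathsf{tlnode}\,b_2\,g$ with $b_1\sqsubseteq b_2$ and $f\,a\sqsubseteq g\,a$ for all $a$. $\mathsf{idl}\,l\,0=\bot$, $\mathsf{idl}(\mathsf{lnode}\,b\,k)(i+1)=\mathsf{tlnode}\,b\,(\lambda x.\,\mathsf{idl}(k\,x)\,i)$. For monotone $h:\mathsf{tlang}_\Sigma\to C$, $\overline h(l):=\sup_i h(\mathsf{idl}\,l\,i)$ (chosen supremum). $\mathsf{fold}\,z\,f$ on $\mathsf{tlang}_\Sigma$: $\bot\mapsto z$, $\mathsf{tlnode}\,b\,k\mapsto f\,b\,(\mathsf{fold}\,z\,f\circ k)$. $\mathsf{tconcat}:=\mathsf{fold}\,(\lambda\_.\emptyset)\,(\lambda b\,k\,l.\,\mathsf{lnode}(b\land\mathsf{o}\,l)(\lambda x.\,k\,x\,l + (\text{if }b\text{ then }\delta_l x\text{ else }\emptyset))) : \mathsf{tlang}_\Sigma\to(\mathsf{lang}_\Sigma\to\mathsf{lang}_\Sigma)$ (codomain ordered pointwise) and $a\cdot b := \overline{\mathsf{tconcat}}\,a\,b$. Conats: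 coinductive $\mathsf{cozero}$, $\mathsf{cosucc}$, with $\omega=\mathsf{cosucc}\,\omega$, basis $\mathbb{N}$ with $\mathsf{idl}\,n\,0=0$, $\mathsf{idl}\,\mathsf{cozero}\,(i+1)=0$, $\mathsf{idl}(\mathsf{cosucc}\,n)(i+1)=\mathsf{idl}\,n\,i+1$. $\mathsf{iter}\,z\,F\,0=z$, $\mathsf{iter}\,z\,F\,(n+1)=F(\mathsf{iter}\,z\,F\,n)$; $\mathsf{coiter}\,F:=\overline{\mathsf{iter}\,\emptyset\,F}$ (extension over the conat basis). $a^* := \mathsf{coiter}\,(\lambda b.\,\mathsf{lnode}\,\mathbf{true}\,(\lambda x.\,\delta_a x\cdot b))\,\omega$. -}

module Defs where

open import Data.Bool using (Bool; true; false; _∧_; _∨_; if_then_else_) renaming (_≤_ to _≤B_)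
open import Data.Nat using (ℕ; zero; suc)
open import Data.Fin using (Fin)
open import Data.List using (List; []; _∷_)
open import Data.Product using (_×_)

-- lang_Σ is the final coalgebra of  X ↦ Bool × (Σ → X).  Since '--guardedness'
-- is not available, we use its standard concrete presentation: a language is
-- its membership function on words.
Lang : ℕ → Set
Lang n = List (Fin n) → Bool

module _ {n : ℕ} where

  o : Lang n → Bool
  o l = l []

  δ : Lang n → Fin n → Lang n
  δ l x w = l (x ∷ w)

  lnode : Bool → (Fin n → Lang n) → Lang n
  lnode b k [] = b
  lnode b k (x ∷ w) = k x w

  -- the coinductive order, unfolded: o and all iterated derivatives compared
  _⊑_ : Lang n → Lang n → Set
  l₁ ⊑ l₂ = ∀ (w : List (Fin n)) → l₁ w ≤B l₂ w

  -- equality of languages = order-equivalence (the paper's axiom)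
  _≈_ : Lang n → Lang n → Set
  l₁ ≈ l₂ = (l₁ ⊑ l₂) × (l₂ ⊑ l₁)

  ∅ : Lang n
  ∅ [] = false
  ∅ (x ∷ w) = ∅ w

  ε : Lang n
  ε [] = true
  ε (x ∷ w) = ∅ w

  infixl 6 _+_
  _+_ : Lang n → Lang n → Lang n
  (a + b) [] = a [] ∨ b []
  (a + b) (x ∷ w) = (δ a x + δ b x) w

  _≤_ : Lang n → Lang n → Set
  x ≤ y = (x + y) ≈ y

data TLang (n : ℕ) : Set where
  ⊥t : TLang n
  tlnode : Bool → (Fin n → TLang n) → TLang n

module _ {n : ℕ} where

  idl : Lang n → ℕ → TLang n
  idl l zero = ⊥t
  idl l (suc i) = tlnode (o l) (λ x → idl (δ l x) i)

  fold : {C : Set} → C → (Bool → (Fin n → C) → C) → TLang n → C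
  fold z f ⊥t = z
  fold z f (tlnode b k) = f b (λ x → fold z f (k x))

  tconcat : TLang n → Lang n → Lang n
  tconcat = fold (λ _ → ∅)
                 (λ b k l → lnode (b ∧ o l) (λ x → k x l + (if b then δ l x else ∅)))

  -- The paper uses a classically chosen supremum (not computable for Bool
  -- observations); for these chains the depth-m part is stable from index m+1,
  -- so the supremum is the diagonal:  o (diag c) = o (c 1),
  -- δ (diag c) x = diag (λ i → δ (c (suc i)) x).
  diag : (ℕ → Lang n) → Lang n
  diag c [] = c 1 []
  diag c (x ∷ w) = diag (λ i → δ (c (suc i)) x) w

  infixl 7 _·_
  _·_ : Lang n → Lang n → Lang n
  a · b = diag (λ i → tconcat (idl a i) b)

iter : {A : Set} → A → (A → A) → ℕ → A
iter z F zero = z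
iter z F (suc k) = F (iter z F k)

module _ {n : ℕ} where

  -- coiter F ω = sup_i iter ∅ F (idl ω i) = sup_i iter ∅ F i,  as idl ω i = i
  coiterω : (Lang n → Lang n) → Lang n
  coiterω F = diag (λ i → iter ∅ F i)

  _* : Lang n → Lang n
  a * = coiterω (λ b → lnode true (λ x → δ a x · b))

{-# OPTIONS --safe #-}
-- All laws are checked pointwise on words.  Concatenation is computed by the
-- Brzozowski recursion  cat a b (x ∷ w) = cat (δ a x) b w ∨ a [] ∧ b (x ∷ w),
-- and a · b agrees with it because the i-th approximant tconcat (idl a i) b is
-- already exact on words shorter than i; the semiring laws of cat then follow
-- by induction on the word from those of (Bool, ∨, ∧).  Likewise the
-- approximants Sₖ = approx a k of a * are stable on words shorter than k, so
-- a * agrees with S (1 + length w) at w.  Since S (1 + k) ⊑ ε ∪ a · Sₖ, the two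
-- induction laws follow by induction on k, and a * · a ⊑ a * is the left
-- induction law for b = a, x = a *.
module Submission where

open import Defs
open import Algebra.Bundles using (CommutativeMonoid)
open import Data.Bool using (Bool; true; false; _∧_; _∨_; if_then_else_; b≤b; f≤t)
  renaming (_≤_ to _≤ᵇ_)
import Data.Bool.Properties as 𝔹
open import Data.List using ([]; _∷_; length)
open import Data.Nat as ℕ using (ℕ; zero; suc; z≤n; s≤s)
import Data.Nat.Properties as ℕₚ
open import Data.Product using (_×_; _,_)
open import Relation.Binary.PropositionalEquality
  using (_≡_; refl; sym; trans; cong; cong₂; _≗_; module ≡-Reasoning)
import Relation.Binary.Reasoning.PartialOrder as PosetReasoning

open import Algebra.Properties.CommutativeSemigroup
  (CommutativeMonoid.commutativeSemigroup 𝔹.∨-commutativeMonoid) using (interchange)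

module ≤ᵇ-Reasoning = PosetReasoning 𝔹.≤-poset

∨-lub : ∀ {p q r} → p ≤ᵇ r → q ≤ᵇ r → p ∨ q ≤ᵇ r
∨-lub {false} _   q≤r = q≤r
∨-lub {true}  p≤r _   = p≤r

p≤p∨q : ∀ p q → p ≤ᵇ p ∨ q
p≤p∨q false q = 𝔹.≤-minimum q
p≤p∨q true  q = b≤b

q≤p∨q : ∀ p q → q ≤ᵇ p ∨ q
q≤p∨q false q = b≤b
q≤p∨q true  q = 𝔹.≤-maximum q

∨-mono-≤ : ∀ {p p′ q q′} → p ≤ᵇ p′ → q ≤ᵇ q′ → p ∨ q ≤ᵇ p′ ∨ q′
∨-mono-≤ {p′ = p′} {q′ = q′} p≤p′ q≤q′ =
  ∨-lub (𝔹.≤-trans p≤p′ (p≤p∨q p′ q′)) (𝔹.≤-trans q≤q′ (q≤p∨q p′ q′))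

∧-mono-≤ : ∀ {p p′ q q′} → p ≤ᵇ p′ → q ≤ᵇ q′ → p ∧ q ≤ᵇ p′ ∧ q′
∧-mono-≤ f≤t         _    = 𝔹.≤-minimum _
∧-mono-≤ {false} b≤b _    = b≤b
∧-mono-≤ {true}  b≤b q≤q′ = q≤q′

p∧q≤q : ∀ p q → p ∧ q ≤ᵇ q
p∧q≤q false q = 𝔹.≤-minimum q
p∧q≤q true  q = b≤b

p≤q⇒p∨q≡q : ∀ {p q} → p ≤ᵇ q → p ∨ q ≡ q
p≤q⇒p∨q≡q f≤t         = refl
p≤q⇒p∨q≡q {false} b≤b = refl
p≤q⇒p∨q≡q {true}  b≤b = refl

module _ {n : ℕ} where

  infixl 6 _∪_
  infixr 7 _◃_
  infix 4 _≗[_]_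

  _∪_ : Lang n → Lang n → Lang n
  (a ∪ b) w = a w ∨ b w

  _◃_ : Bool → Lang n → Lang n
  (β ◃ a) w = β ∧ a w

  _≗[_]_ : Lang n → ℕ → Lang n → Set
  a ≗[ m ] b = ∀ v → length v ℕ.≤ m → a v ≡ b v

  ⊑-refl : ∀ {a : Lang n} → a ⊑ a
  ⊑-refl w = 𝔹.≤-refl

  ⊑-trans : ∀ {a b c : Lang n} → a ⊑ b → b ⊑ c → a ⊑ c
  ⊑-trans a⊑b b⊑c w = 𝔹.≤-trans (a⊑b w) (b⊑c w)

  a∪b⊑c⇒a⊑c : ∀ {a b c : Lang n} → (a ∪ b) ⊑ c → a ⊑ c
  a∪b⊑c⇒a⊑c {a} {b} a∪b⊑c w = 𝔹.≤-trans (p≤p∨q (a w) (b w)) (a∪b⊑c w)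

  a∪b⊑c⇒b⊑c : ∀ {a b c : Lang n} → (a ∪ b) ⊑ c → b ⊑ c
  a∪b⊑c⇒b⊑c {a} {b} a∪b⊑c w = 𝔹.≤-trans (q≤p∨q (a w) (b w)) (a∪b⊑c w)

  ≗⇒⊑ : ∀ {a b : Lang n} → a ≗ b → a ⊑ b
  ≗⇒⊑ a≗b w = 𝔹.≤-reflexive (a≗b w)

  ≗⇒⊒ : ∀ {a b : Lang n} → a ≗ b → b ⊑ a
  ≗⇒⊒ a≗b w = 𝔹.≤-reflexive (sym (a≗b w))

  ≗⇒≈ : ∀ {a b : Lang n} → a ≗ b → a ≈ b
  ≗⇒≈ a≗b = ≗⇒⊑ a≗b , ≗⇒⊒ a≗b

  ∅-at : ∅ {n} ≗ λ _ → false
  ∅-at []      = refl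
  ∅-at (x ∷ w) = ∅-at w

  +-at : ∀ (a b : Lang n) → a + b ≗ a ∪ b
  +-at a b []      = refl
  +-at a b (x ∷ w) = +-at (δ a x) (δ b x) w

  ⊑⇒≤ : ∀ {a b : Lang n} → a ⊑ b → a ≤ b
  ⊑⇒≤ {a} {b} a⊑b = ≗⇒≈ λ w → trans (+-at a b w) (p≤q⇒p∨q≡q (a⊑b w))

  ≤⇒⊑ : ∀ {a b : Lang n} → a ≤ b → a ⊑ b
  ≤⇒⊑ {a} {b} (a+b⊑b , _) w =
    𝔹.≤-trans (p≤p∨q (a w) (b w)) (𝔹.≤-trans (𝔹.≤-reflexive (sym (+-at a b w))) (a+b⊑b w))

  +-assoc : ∀ (a b c : Lang n) → (a + b) + c ≗ a + (b + c)
  +-assoc a b c []      = 𝔹.∨-assoc (a []) (b []) (c [])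
  +-assoc a b c (x ∷ w) = +-assoc (δ a x) (δ b x) (δ c x) w

  +-comm : ∀ (a b : Lang n) → a + b ≗ b + a
  +-comm a b []      = 𝔹.∨-comm (a []) (b [])
  +-comm a b (x ∷ w) = +-comm (δ a x) (δ b x) w

  +-idem : ∀ (a : Lang n) → a + a ≗ a
  +-idem a []      = 𝔹.∨-idem (a [])
  +-idem a (x ∷ w) = +-idem (δ a x) w

  +-identityˡ : ∀ (a : Lang n) → ∅ + a ≗ a
  +-identityˡ a []      = refl
  +-identityˡ a (x ∷ w) = +-identityˡ (δ a x) w

  +-identityʳ : ∀ (a : Lang n) → a + ∅ ≗ a
  +-identityʳ a []      = 𝔹.∨-identityʳ (a [])
  +-identityʳ a (x ∷ w) = +-identityʳ (δ a x) w

  -- Concatenation by recursion on the word; δ (cat a b) x is definitionally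
  -- cat (δ a x) b ∪ a [] ◃ δ b x, the pointwise form of the step of tconcat.
  cat : Lang n → Lang n → Lang n
  cat a b []      = a [] ∧ b []
  cat a b (x ∷ w) = cat (δ a x) b w ∨ a [] ∧ b (x ∷ w)

  cat-congˡ-upTo : ∀ {a a′} b w → a ≗[ length w ] a′ → cat a b w ≡ cat a′ b w
  cat-congˡ-upTo b []      a≗a′ = cong (_∧ b []) (a≗a′ [] z≤n)
  cat-congˡ-upTo b (x ∷ w) a≗a′ =
    cong₂ _∨_ (cat-congˡ-upTo b w λ v ∣v∣≤∣w∣ → a≗a′ (x ∷ v) (s≤s ∣v∣≤∣w∣))
              (cong (_∧ b (x ∷ w)) (a≗a′ [] z≤n))

  cat-congʳ-upTo : ∀ a {b b′} w → b ≗[ length w ] b′ → cat a b w ≡ cat a b′ w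
  cat-congʳ-upTo a []      b≗b′ = cong (a [] ∧_) (b≗b′ [] z≤n)
  cat-congʳ-upTo a (x ∷ w) b≗b′ =
    cong₂ _∨_ (cat-congʳ-upTo (δ a x) w λ v ∣v∣≤∣w∣ → b≗b′ v (ℕₚ.m≤n⇒m≤1+n ∣v∣≤∣w∣))
              (cong (a [] ∧_) (b≗b′ (x ∷ w) ℕₚ.≤-refl))

  cat-congˡ : ∀ {a a′} b → a ≗ a′ → cat a b ≗ cat a′ b
  cat-congˡ b a≗a′ w = cat-congˡ-upTo b w λ v _ → a≗a′ v

  cat-congʳ : ∀ a {b b′} → b ≗ b′ → cat a b ≗ cat a b′
  cat-congʳ a b≗b′ w = cat-congʳ-upTo a w λ v _ → b≗b′ v

  cat-mono-⊑ : ∀ {a a′ b b′} → a ⊑ a′ → b ⊑ b′ → cat a b ⊑ cat a′ b′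
  cat-mono-⊑ a⊑a′ b⊑b′ []      = ∧-mono-≤ (a⊑a′ []) (b⊑b′ [])
  cat-mono-⊑ a⊑a′ b⊑b′ (x ∷ w) =
    ∨-mono-≤ (cat-mono-⊑ (λ v → a⊑a′ (x ∷ v)) b⊑b′ w) (∧-mono-≤ (a⊑a′ []) (b⊑b′ (x ∷ w)))

  cat-zeroˡ : ∀ b → cat ∅ b ≗ λ _ → false
  cat-zeroˡ b []      = refl
  cat-zeroˡ b (x ∷ w) = trans (𝔹.∨-identityʳ _) (cat-zeroˡ b w)

  ◃-∅ : ∀ β → β ◃ ∅ {n} ≗ λ _ → false
  ◃-∅ β w = trans (cong (β ∧_) (∅-at w)) (𝔹.∧-zeroʳ β)

  cat-zeroʳ : ∀ a → cat a ∅ ≗ λ _ → false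
  cat-zeroʳ a []      = 𝔹.∧-zeroʳ (a [])
  cat-zeroʳ a (x ∷ w) = cong₂ _∨_ (cat-zeroʳ (δ a x) w) (◃-∅ (a []) w)

  cat-identityˡ : ∀ b → cat ε b ≗ b
  cat-identityˡ b []      = refl
  cat-identityˡ b (x ∷ w) = cong (_∨ b (x ∷ w)) (cat-zeroˡ b w)

  cat-identityʳ : ∀ a → cat a ε ≗ a
  cat-identityʳ a []      = 𝔹.∧-identityʳ (a [])
  cat-identityʳ a (x ∷ w) =
    trans (cong₂ _∨_ (cat-identityʳ (δ a x) w) (◃-∅ (a []) w)) (𝔹.∨-identityʳ _)

  cat-distribʳ-∪ : ∀ a b c → cat (a ∪ b) c ≗ cat a c ∪ cat b c
  cat-distribʳ-∪ a b c []      = 𝔹.∧-distribʳ-∨ (c []) (a []) (b [])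
  cat-distribʳ-∪ a b c (x ∷ w) =
    trans (cong₂ _∨_ (cat-distribʳ-∪ (δ a x) (δ b x) c w) (𝔹.∧-distribʳ-∨ γ (a []) (b [])))
          (interchange (cat (δ a x) c w) (cat (δ b x) c w) (a [] ∧ γ) (b [] ∧ γ))
    where
      γ : Bool
      γ = c (x ∷ w)

  cat-distribˡ-∪ : ∀ a b c → cat a (b ∪ c) ≗ cat a b ∪ cat a c
  cat-distribˡ-∪ a b c []      = 𝔹.∧-distribˡ-∨ (a []) (b []) (c [])
  cat-distribˡ-∪ a b c (x ∷ w) =
    trans (cong₂ _∨_ (cat-distribˡ-∪ (δ a x) b c w) (𝔹.∧-distribˡ-∨ (a []) (b (x ∷ w)) (c (x ∷ w))))
          (interchange (cat (δ a x) b w) (cat (δ a x) c w) (a [] ∧ b (x ∷ w)) (a [] ∧ c (x ∷ w)))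

  cat-◃ˡ : ∀ β a c → cat (β ◃ a) c ≗ β ◃ cat a c
  cat-◃ˡ β a c []      = 𝔹.∧-assoc β (a []) (c [])
  cat-◃ˡ β a c (x ∷ w) =
    trans (cong₂ _∨_ (cat-◃ˡ β (δ a x) c w) (𝔹.∧-assoc β (a []) _))
          (sym (𝔹.∧-distribˡ-∨ β _ _))

  cat-assoc : ∀ a b c → cat (cat a b) c ≗ cat a (cat b c)
  cat-assoc a b c []      = 𝔹.∧-assoc (a []) (b []) (c [])
  cat-assoc a b c (x ∷ w) = begin
    cat (cat (δ a x) b ∪ α ◃ δ b x) c w ∨ (α ∧ b []) ∧ γ
      ≡⟨ cong (_∨ (α ∧ b []) ∧ γ) (cat-distribʳ-∪ (cat (δ a x) b) (α ◃ δ b x) c w) ⟩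
    (cat (cat (δ a x) b) c w ∨ cat (α ◃ δ b x) c w) ∨ (α ∧ b []) ∧ γ
      ≡⟨ cong₂ (λ p q → (p ∨ q) ∨ (α ∧ b []) ∧ γ) (cat-assoc (δ a x) b c w) (cat-◃ˡ α (δ b x) c w) ⟩
    (P ∨ α ∧ Q) ∨ (α ∧ b []) ∧ γ  ≡⟨ 𝔹.∨-assoc P (α ∧ Q) ((α ∧ b []) ∧ γ) ⟩
    P ∨ (α ∧ Q ∨ (α ∧ b []) ∧ γ)  ≡⟨ cong (λ r → P ∨ (α ∧ Q ∨ r)) (𝔹.∧-assoc α (b []) γ) ⟩
    P ∨ (α ∧ Q ∨ α ∧ b [] ∧ γ)    ≡⟨ cong (P ∨_) (𝔹.∧-distribˡ-∨ α Q (b [] ∧ γ)) ⟨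
    P ∨ α ∧ (Q ∨ b [] ∧ γ)        ∎
    where
      open ≡-Reasoning
      α γ P Q : Bool
      α = a []
      γ = c (x ∷ w)
      P = cat (δ a x) (cat b c) w
      Q = cat (δ b x) c w

  if-at : ∀ β (a : Lang n) → (if β then a else ∅) ≗ β ◃ a
  if-at true  a w = refl
  if-at false a w = ∅-at w

  diag-at : ∀ (c : ℕ → Lang n) w → diag c w ≡ c (suc (length w)) w
  diag-at c []      = refl
  diag-at c (x ∷ w) = diag-at (λ i → δ (c (suc i)) x) w

  tconcat-idl : ∀ a b w {i} → length w ℕ.< i → tconcat (idl a i) b w ≡ cat a b w
  tconcat-idl a b []      {suc i} _            = refl
  tconcat-idl a b (x ∷ w) {suc i} (s≤s ∣w∣<i) =
    trans (+-at _ _ w) (cong₂ _∨_ (tconcat-idl (δ a x) b w ∣w∣<i) (if-at (a []) (δ b x) w))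

  ·-at : ∀ a b → a · b ≗ cat a b
  ·-at a b w = trans (diag-at _ w) (tconcat-idl a b w ℕₚ.≤-refl)

  +-·-at : ∀ b a c → b + a · c ≗ b ∪ cat a c
  +-·-at b a c w = trans (+-at b (a · c) w) (cong (b w ∨_) (·-at a c w))

  module _ (a : Lang n) where

    approx : ℕ → Lang n
    approx = iter ∅ (λ b → lnode true (λ x → δ a x · b))

    approx-suc-∷ : ∀ k x w → approx (suc k) (x ∷ w) ≡ cat (δ a x) (approx k) w
    approx-suc-∷ k x = ·-at (δ a x) (approx k)

    approx-stable : ∀ {m j k} → m ℕ.< j → m ℕ.< k → approx j ≗[ m ] approx k
    approx-stable {j = suc j} {k = suc k} _ _ [] _ = refl
    approx-stable {suc m} {suc j} {suc k} (s≤s m<j) (s≤s m<k) (x ∷ v) (s≤s ∣v∣≤m) = begin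
      approx (suc j) (x ∷ v)    ≡⟨ approx-suc-∷ j x v ⟩
      cat (δ a x) (approx j) v  ≡⟨ cat-congʳ-upTo (δ a x) v approx-j≗approx-k ⟩
      cat (δ a x) (approx k) v  ≡⟨ approx-suc-∷ k x v ⟨
      approx (suc k) (x ∷ v)    ∎
      where
        open ≡-Reasoning
        approx-j≗approx-k : approx j ≗[ length v ] approx k
        approx-j≗approx-k u ∣u∣≤∣v∣ = approx-stable m<j m<k u (ℕₚ.≤-trans ∣u∣≤∣v∣ ∣v∣≤m)

    *-≗-approx : ∀ m → a * ≗[ m ] approx (suc m)
    *-≗-approx m v ∣v∣≤m = trans (diag-at _ v) (approx-stable ℕₚ.≤-refl (s≤s ∣v∣≤m) v ℕₚ.≤-refl)

    *-∷ : ∀ x w → (a *) (x ∷ w) ≡ cat (δ a x) (a *) w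
    *-∷ x w = begin
      (a *) (x ∷ w)                               ≡⟨ *-≗-approx (suc (length w)) (x ∷ w) ℕₚ.≤-refl ⟩
      approx (suc (suc (length w))) (x ∷ w)       ≡⟨ approx-suc-∷ (suc (length w)) x w ⟩
      cat (δ a x) (approx (suc (length w))) w     ≡⟨ cat-congʳ-upTo (δ a x) w (*-≗-approx (length w)) ⟨
      cat (δ a x) (a *) w                         ∎
      where open ≡-Reasoning

    approx-suc-⊑ : ∀ k → approx (suc k) ⊑ (ε ∪ cat a (approx k))
    approx-suc-⊑ k []      = b≤b
    approx-suc-⊑ k (x ∷ w) = begin
      approx (suc k) (x ∷ w)                              ≡⟨ approx-suc-∷ k x w ⟩
      cat (δ a x) (approx k) w                            ≤⟨ p≤p∨q _ _ ⟩
      cat (δ a x) (approx k) w ∨ a [] ∧ approx k (x ∷ w)  ≤⟨ q≤p∨q (∅ w) _ ⟩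
      (ε ∪ cat a (approx k)) (x ∷ w)                      ∎
      where open ≤ᵇ-Reasoning

    approx-inductionˡ : ∀ {b x} → (b ∪ cat a x) ⊑ x → ∀ k → cat (approx k) b ⊑ x
    approx-inductionˡ {b} {x} _ zero w = begin
      cat ∅ b w  ≡⟨ cat-zeroˡ b w ⟩
      false      ≤⟨ 𝔹.≤-minimum (x w) ⟩
      x w        ∎
      where open ≤ᵇ-Reasoning
    approx-inductionˡ {b} {x} b+ax⊑x (suc k) w = begin
      cat (approx (suc k)) b w                 ≤⟨ cat-mono-⊑ (approx-suc-⊑ k) ⊑-refl w ⟩
      cat (ε ∪ cat a (approx k)) b w           ≡⟨ cat-distribʳ-∪ ε (cat a (approx k)) b w ⟩
      cat ε b w ∨ cat (cat a (approx k)) b w   ≡⟨ cong₂ _∨_ (cat-identityˡ b w) (cat-assoc a (approx k) b w) ⟩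
      b w ∨ cat a (cat (approx k) b) w         ≤⟨ ∨-mono-≤ 𝔹.≤-refl (cat-mono-⊑ ⊑-refl (approx-inductionˡ b+ax⊑x k) w) ⟩
      b w ∨ cat a x w                          ≤⟨ b+ax⊑x w ⟩
      x w                                      ∎
      where open ≤ᵇ-Reasoning

    approx-inductionʳ : ∀ {b x} → (b ∪ cat x a) ⊑ x → ∀ k → cat b (approx k) ⊑ x
    approx-inductionʳ {b} {x} _ zero w = begin
      cat b ∅ w  ≡⟨ cat-zeroʳ b w ⟩
      false      ≤⟨ 𝔹.≤-minimum (x w) ⟩
      x w        ∎
      where open ≤ᵇ-Reasoning
    approx-inductionʳ {b} {x} b+xa⊑x (suc k) w = begin
      cat b (approx (suc k)) w                 ≤⟨ cat-mono-⊑ ⊑-refl (approx-suc-⊑ k) w ⟩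
      cat b (ε ∪ cat a (approx k)) w           ≡⟨ cat-distribˡ-∪ b ε (cat a (approx k)) w ⟩
      cat b ε w ∨ cat b (cat a (approx k)) w   ≡⟨ cong₂ _∨_ (cat-identityʳ b w) (sym (cat-assoc b a (approx k) w)) ⟩
      b w ∨ cat (cat b a) (approx k) w         ≤⟨ ∨-lub (b⊑x w) (approx-inductionʳ ba+xa⊑x k w) ⟩
      x w                                      ∎
      where
        open ≤ᵇ-Reasoning
        b⊑x : b ⊑ x
        b⊑x = a∪b⊑c⇒a⊑c b+xa⊑x
        xa⊑x : cat x a ⊑ x
        xa⊑x = a∪b⊑c⇒b⊑c b+xa⊑x
        ba+xa⊑x : (cat b a ∪ cat x a) ⊑ x
        ba+xa⊑x v = ∨-lub (𝔹.≤-trans (cat-mono-⊑ b⊑x ⊑-refl v) (xa⊑x v)) (xa⊑x v)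

    *-inductionˡ-cat : ∀ {b x} → (b ∪ cat a x) ⊑ x → cat (a *) b ⊑ x
    *-inductionˡ-cat {b} {x} b+ax⊑x w = begin
      cat (a *) b w                      ≡⟨ cat-congˡ-upTo b w (*-≗-approx (length w)) ⟩
      cat (approx (suc (length w))) b w  ≤⟨ approx-inductionˡ b+ax⊑x (suc (length w)) w ⟩
      x w                                ∎
      where open ≤ᵇ-Reasoning

    *-inductionʳ-cat : ∀ {b x} → (b ∪ cat x a) ⊑ x → cat b (a *) ⊑ x
    *-inductionʳ-cat {b} {x} b+xa⊑x w = begin
      cat b (a *) w                      ≡⟨ cat-congʳ-upTo b w (*-≗-approx (length w)) ⟩
      cat b (approx (suc (length w))) w  ≤⟨ approx-inductionʳ b+xa⊑x (suc (length w)) w ⟩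
      x w                                ∎
      where open ≤ᵇ-Reasoning

    *-unfoldˡ-cat : (ε ∪ cat a (a *)) ⊑ (a *)
    *-unfoldˡ-cat []      = 𝔹.≤-maximum _
    *-unfoldˡ-cat (x ∷ w) =
      ∨-lub (𝔹.≤-trans (𝔹.≤-reflexive (∅-at w)) (𝔹.≤-minimum _))
            (∨-lub (𝔹.≤-reflexive (sym (*-∷ x w))) (p∧q≤q (a []) _))

    *-unfoldʳ-cat : (ε ∪ cat (a *) a) ⊑ (a *)
    *-unfoldʳ-cat w = ∨-lub (ε⊑* w) (*-inductionˡ-cat a+aa*⊑a* w)
      where
        ε⊑* : ε ⊑ (a *)
        ε⊑* = a∪b⊑c⇒a⊑c *-unfoldˡ-cat
        aa*⊑a* : cat a (a *) ⊑ (a *)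
        aa*⊑a* = a∪b⊑c⇒b⊑c *-unfoldˡ-cat
        a+aa*⊑a* : (a ∪ cat a (a *)) ⊑ (a *)
        a+aa*⊑a* v = ∨-lub (𝔹.≤-trans (𝔹.≤-reflexive (sym (cat-identityʳ a v)))
                                      (𝔹.≤-trans (cat-mono-⊑ ⊑-refl ε⊑* v) (aa*⊑a* v)))
                           (aa*⊑a* v)

  ·-assoc : ∀ (a b c : Lang n) → (a · b) · c ≗ a · (b · c)
  ·-assoc a b c w = begin
    ((a · b) · c) w    ≡⟨ ·-at (a · b) c w ⟩
    cat (a · b) c w    ≡⟨ cat-congˡ c (·-at a b) w ⟩
    cat (cat a b) c w  ≡⟨ cat-assoc a b c w ⟩
    cat a (cat b c) w  ≡⟨ cat-congʳ a (·-at b c) w ⟨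
    cat a (b · c) w    ≡⟨ ·-at a (b · c) w ⟨
    (a · (b · c)) w    ∎
    where open ≡-Reasoning

  ·-identityˡ : ∀ (a : Lang n) → ε · a ≗ a
  ·-identityˡ a w = trans (·-at ε a w) (cat-identityˡ a w)

  ·-identityʳ : ∀ (a : Lang n) → a · ε ≗ a
  ·-identityʳ a w = trans (·-at a ε w) (cat-identityʳ a w)

  ·-distribˡ-+ : ∀ (a b c : Lang n) → a · (b + c) ≗ a · b + a · c
  ·-distribˡ-+ a b c w = begin
    (a · (b + c)) w        ≡⟨ ·-at a (b + c) w ⟩
    cat a (b + c) w        ≡⟨ cat-congʳ a (+-at b c) w ⟩
    cat a (b ∪ c) w        ≡⟨ cat-distribˡ-∪ a b c w ⟩
    cat a b w ∨ cat a c w  ≡⟨ cong₂ _∨_ (·-at a b w) (·-at a c w) ⟨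
    (a · b) w ∨ (a · c) w  ≡⟨ +-at (a · b) (a · c) w ⟨
    (a · b + a · c) w      ∎
    where open ≡-Reasoning

  ·-distribʳ-+ : ∀ (a b c : Lang n) → (a + b) · c ≗ a · c + b · c
  ·-distribʳ-+ a b c w = begin
    ((a + b) · c) w        ≡⟨ ·-at (a + b) c w ⟩
    cat (a + b) c w        ≡⟨ cat-congˡ c (+-at a b) w ⟩
    cat (a ∪ b) c w        ≡⟨ cat-distribʳ-∪ a b c w ⟩
    cat a c w ∨ cat b c w  ≡⟨ cong₂ _∨_ (·-at a c w) (·-at b c w) ⟨
    (a · c) w ∨ (b · c) w  ≡⟨ +-at (a · c) (b · c) w ⟨
    (a · c + b · c) w      ∎
    where open ≡-Reasoning

  ·-zeroˡ : ∀ (a : Lang n) → ∅ · a ≗ ∅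
  ·-zeroˡ a w = trans (·-at ∅ a w) (trans (cat-zeroˡ a w) (sym (∅-at w)))

  ·-zeroʳ : ∀ (a : Lang n) → a · ∅ ≗ ∅
  ·-zeroʳ a w = trans (·-at a ∅ w) (trans (cat-zeroʳ a w) (sym (∅-at w)))

  *-unfoldˡ : ∀ (a : Lang n) → (ε + a · a *) ≤ (a *)
  *-unfoldˡ a = ⊑⇒≤ (⊑-trans (≗⇒⊑ (+-·-at ε a (a *))) (*-unfoldˡ-cat a))

  *-unfoldʳ : ∀ (a : Lang n) → (ε + a * · a) ≤ (a *)
  *-unfoldʳ a = ⊑⇒≤ (⊑-trans (≗⇒⊑ (+-·-at ε (a *) a)) (*-unfoldʳ-cat a))

  *-inductionˡ : ∀ (a b x : Lang n) → (b + a · x) ≤ x → (a * · b) ≤ x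
  *-inductionˡ a b x b+ax≤x = ⊑⇒≤ (⊑-trans (≗⇒⊑ (·-at (a *) b))
    (*-inductionˡ-cat a (⊑-trans (≗⇒⊒ (+-·-at b a x)) (≤⇒⊑ b+ax≤x))))

  *-inductionʳ : ∀ (a b x : Lang n) → (b + x · a) ≤ x → (b · a *) ≤ x
  *-inductionʳ a b x b+xa≤x = ⊑⇒≤ (⊑-trans (≗⇒⊑ (·-at b (a *)))
    (*-inductionʳ-cat a (⊑-trans (≗⇒⊒ (+-·-at b x a)) (≤⇒⊑ b+xa≤x))))

mainTheorem5 : (n : ℕ) →
      (∀ (a b c : Lang n) → ((a + b) + c) ≈ (a + (b + c)))
    × (∀ (a b : Lang n) → (a + b) ≈ (b + a))
    × (∀ (a : Lang n) → (a + a) ≈ a)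
    × (∀ (a : Lang n) → (∅ + a) ≈ a)
    × (∀ (a : Lang n) → (a + ∅) ≈ a)
    × (∀ (a b c : Lang n) → ((a · b) · c) ≈ (a · (b · c)))
    × (∀ (a : Lang n) → (ε · a) ≈ a)
    × (∀ (a : Lang n) → (a · ε) ≈ a)
    × (∀ (a b c : Lang n) → (a · (b + c)) ≈ ((a · b) + (a · c)))
    × (∀ (a b c : Lang n) → ((a + b) · c) ≈ ((a · c) + (b · c)))
    × (∀ (a : Lang n) → (∅ · a) ≈ ∅)
    × (∀ (a : Lang n) → (a · ∅) ≈ ∅)
    × (∀ (a : Lang n) → (ε + (a · (a *))) ≤ (a *))
    × (∀ (a : Lang n) → (ε + ((a *) · a)) ≤ (a *))
    × (∀ (a b x : Lang n) → (b + (a · x)) ≤ x → ((a *) · b) ≤ x)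
    × (∀ (a b x : Lang n) → (b + (x · a)) ≤ x → (b · (a *)) ≤ x)
mainTheorem5 n =
    (λ a b c → ≗⇒≈ (+-assoc a b c))
  , (λ a b → ≗⇒≈ (+-comm a b))
  , (λ a → ≗⇒≈ (+-idem a))
  , (λ a → ≗⇒≈ (+-identityˡ a))
  , (λ a → ≗⇒≈ (+-identityʳ a))
  , (λ a b c → ≗⇒≈ (·-assoc a b c))
  , (λ a → ≗⇒≈ (·-identityˡ a))
  , (λ a → ≗⇒≈ (·-identityʳ a))
  , (λ a b c → ≗⇒≈ (·-distribˡ-+ a b c))
  , (λ a b c → ≗⇒≈ (·-distribʳ-+ a b c))
  , (λ a → ≗⇒≈ (·-zeroˡ a))
  , (λ a → ≗⇒≈ (·-zeroʳ a))
  , *-unfoldˡ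
  , *-unfoldʳ
  , *-inductionˡ
  , *-inductionʳ
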